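{- Let $G$ be a graph of order $n\ge 2$ and let $H$ be a graph with at least two vertices and root vertex $v$. If every $\gamma_R(H)$-function $f$ satisfies $f(v)=1$, then $$\gamma_R(G\circ H)=n(\gamma_R(H)-1)+\gamma_R(G).$$
   Context: All graphs are finite, simple and undirected. A Roman dominating function on $G=(V,E)$ is a map $f:V\to\{0,1,2\}$ such that every vertex $u$ with $f(u)=0$ has a neighbor $w$ with $f(w)=2$; its weight is $\sum_{u\in V}f(u)$; $\gamma_R(G)$ is the minimum weight of a Roman dominating function, and a $\gamma_R(G)$-function is one of weight $\gamma_R(G)$. For $G$ with vertex set $\{v_1,\dots,v_n\}$ and $H$ with root $v$, the rooted product $G\circ H$ is obtained from one copy of $G$ and $n$ copies $H_1,\dots,H_n$ of $H$ by identifying each $v_i$ with the copy of $v$ in $H_i$. -}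

module Defs where

open import Data.Nat using (ℕ; zero; suc; _+_; _*_; _≤_)
open import Data.Fin using (Fin; toℕ; remQuot; combine)
open import Data.Fin.Properties using (_≟_)
open import Data.Bool using (Bool; true; false; _∧_; _∨_)
open import Data.Bool.Properties using (∧-zeroʳ; ∧-comm)
open import Data.List using (List; map; allFin)
open import Data.Nat.ListAction using (sum)
open import Data.Product using (Σ; ∃; _×_; _,_; proj₁; proj₂)
open import Relation.Nullary using (yes; no)
open import Relation.Nullary.Decidable using (⌊_⌋)
open import Relation.Binary.PropositionalEquality using (_≡_; refl; sym; cong₂)

record Graph (n : ℕ) : Set where
  field
    Adj     : Fin n → Fin n → Bool
    Adj-sym : ∀ u w → Adj u w ≡ Adj w u
    Adj-irr : ∀ u → Adj u u ≡ false
open Graph public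

IsRDF : ∀ {n} → Graph n → (Fin n → Fin 3) → Set
IsRDF {n} G f = ∀ u → toℕ (f u) ≡ 0 → ∃ λ (w : Fin n) → Adj G u w ≡ true × toℕ (f w) ≡ 2

weight : ∀ {n} → (Fin n → Fin 3) → ℕ
weight {n} f = sum (map (λ u → toℕ (f u)) (allFin n))

IsγR : ∀ {n} → Graph n → ℕ → Set
IsγR G k = (∃ λ f → IsRDF G f × weight f ≡ k) × (∀ f → IsRDF G f → k ≤ weight f)

IsγRFunction : ∀ {n} → Graph n → ℕ → (Fin n → Fin 3) → Set
IsγRFunction G k f = IsRDF G f × weight f ≡ k

_==_ : ∀ {n} → Fin n → Fin n → Bool
i == j = ⌊ i ≟ j ⌋

==-sym : ∀ {n} (i j : Fin n) → (i == j) ≡ (j == i)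
==-sym i j with i ≟ j | j ≟ i
... | yes _ | yes _ = refl
... | no _  | no _  = refl
... | yes p | no q  with q (sym p)
... | ()
==-sym i j | no p | yes q with p (sym q)
... | ()

-- Rooted product adjacency on pairs: (i , x) is vertex x of the copy H_i;
-- (i , v) is identified with vertex v_i of G.
rpAdj : ∀ {n m} → Graph n → Graph m → Fin m → (Fin n × Fin m) → (Fin n × Fin m) → Bool
rpAdj G H v (i , x) (j , y) =
  ((i == j) ∧ Adj H x y) ∨ (((x == v) ∧ (y == v)) ∧ Adj G i j)

rpAdj-sym : ∀ {n m} (G : Graph n) (H : Graph m) v p q → rpAdj G H v p q ≡ rpAdj G H v q p
rpAdj-sym G H v (i , x) (j , y) =
  cong₂ _∨_ (cong₂ _∧_ (==-sym i j) (Adj-sym H x y))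
            (cong₂ _∧_ (∧-comm (x == v) (y == v)) (Adj-sym G i j))

rpAdj-irr : ∀ {n m} (G : Graph n) (H : Graph m) v p → rpAdj G H v p p ≡ false
rpAdj-irr G H v (i , x) rewrite Adj-irr H x | Adj-irr G i
  | ∧-zeroʳ (i == i) | ∧-zeroʳ ((x == v) ∧ (x == v)) = refl

rootedProduct : ∀ {n m} → Graph n → (H : Graph m) → Fin m → Graph (n * m)
rootedProduct {n} {m} G H v = record
  { Adj     = λ a b → rpAdj G H v (remQuot m a) (remQuot m b)
  ; Adj-sym = λ a b → rpAdj-sym G H v (remQuot m a) (remQuot m b)
  ; Adj-irr = λ a → rpAdj-irr G H v (remQuot m a)
  }

module Submission where

-- Roman domination of a rooted product.  Write γ_R(H) = g + 1 and assume that
-- every γ_R(H)-function labels the root v with 1.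
--
-- Upper bound: label the roots v_1, …, v_n by a γ_R(G)-function g₀ and the
-- non-root vertices of every copy H_i by a γ_R(H)-function f₀.  As f₀(v) = 1,
-- no non-root vertex relies on the root, so this glued labelling is a Roman
-- dominating function of G ∘ H of weight n·g + γ_R(G).
--
-- Lower bound: the restriction h_i of an RDF F of G ∘ H to the copy H_i
-- dominates all non-root vertices of H_i from inside the copy.  Such an h_i
-- weighs at least g + c_i for a "contribution" c_i ∈ {0,1,2} with c_i = 0
-- only if the root is not dominated inside H_i, and c_i = 2 whenever
-- h_i(v) = 2 (the hypothesis on γ_R(H)-functions is used here).  Then c is an
-- RDF of G, so w(F) ≥ n·g + γ_R(G).

open import Defs
open import Data.Nat using (ℕ; zero; suc; _*_; _+_; _∸_; _≤_; z≤n)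
open import Data.Nat.Properties
  using (+-comm; +-assoc; +-suc; +-mono-≤; +-monoʳ-≤; ≤-antisym; ≤∧≢⇒<; m≤m+n; suc-injective;
         +-cancelˡ-≤; +-0-commutativeMonoid; +-commutativeSemigroup; module ≤-Reasoning)
  renaming (_≟_ to _≟ℕ_)
open import Data.Nat.ListAction using () renaming (sum to listSum)
open import Data.Fin using (Fin; zero; suc; toℕ; combine; remQuot; _↑ˡ_; _↑ʳ_; punchIn)
open import Data.Fin.Patterns using (0F; 1F; 2F)
open import Data.Fin.Properties using (_≟_; any?; remQuot-combine; combine-remQuot; punchInᵢ≢i)
open import Data.Bool using (true; _∧_; _∨_)
open import Data.Bool.Properties using (∨-sel; ∨-zeroʳ; ∧-conicalˡ; ∧-conicalʳ; T-≡)
  renaming (_≟_ to _≟ᵇ_)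
open import Data.List using (tabulate)
open import Data.List.Properties using (map-tabulate)
open import Data.Vec.Functional using (updateAt)
open import Data.Vec.Functional.Properties using (updateAt-updates; updateAt-minimal)
open import Data.Product using (Σ; ∃; _×_; _,_; proj₁; proj₂; uncurry)
open import Data.Sum as Sum using (_⊎_; inj₁; inj₂)
open import Function using (_∘_; id; const; Equivalence)
open import Relation.Nullary using (¬_; Dec; yes; no; contradiction)
open import Relation.Nullary.Decidable using (_×-dec_; toWitness; dec-true; isYes≗does)
open import Relation.Binary.PropositionalEquality
open import Algebra.Properties.CommutativeMonoid.Sum +-0-commutativeMonoid
  using (sum; sum-syntax; ∑-distrib-+; sum-cong-≗; sum-remove)
open import Algebra.Properties.CommutativeSemigroup +-commutativeSemigroup using (x∙yz≈y∙xz)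

listSum-tabulate : ∀ {k} (φ : Fin k → ℕ) → listSum (tabulate φ) ≡ ∑[ x < k ] φ x
listSum-tabulate {zero}  φ = refl
listSum-tabulate {suc k} φ = cong (φ zero +_) (listSum-tabulate (φ ∘ suc))

∑-mono-≤ : ∀ {k} {φ ψ : Fin k → ℕ} → (∀ x → φ x ≤ ψ x) → ∑[ x < k ] φ x ≤ ∑[ x < k ] ψ x
∑-mono-≤ {zero}  le = z≤n
∑-mono-≤ {suc k} le = +-mono-≤ (le zero) (∑-mono-≤ (le ∘ suc))

∑-const : ∀ k c → ∑[ x < k ] c ≡ k * c
∑-const zero    c = refl
∑-const (suc k) c = cong (c +_) (∑-const k c)

∑-+-const : ∀ {k} (φ : Fin k → ℕ) c → ∑[ x < k ] (φ x + c) ≡ k * c + ∑[ x < k ] φ x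
∑-+-const {k} φ c = begin
  ∑[ x < k ] (φ x + c)          ≡⟨ ∑-distrib-+ φ (const c) ⟩
  ∑[ x < k ] φ x + ∑[ x < k ] c ≡⟨ cong (∑[ x < k ] φ x +_) (∑-const k c) ⟩
  ∑[ x < k ] φ x + k * c        ≡⟨ +-comm _ (k * c) ⟩
  k * c + ∑[ x < k ] φ x        ∎
  where open ≡-Reasoning

∑-↑ : ∀ a {b} (φ : Fin (a + b) → ℕ) →
      ∑[ x < a + b ] φ x ≡ ∑[ x < a ] φ (x ↑ˡ b) + ∑[ y < b ] φ (a ↑ʳ y)
∑-↑ zero    φ = refl
∑-↑ (suc a) φ = trans (cong (φ zero +_) (∑-↑ a (φ ∘ suc))) (sym (+-assoc (φ zero) _ _))

∑-combine : ∀ a b (φ : Fin (a * b) → ℕ) →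
            ∑[ z < a * b ] φ z ≡ ∑[ i < a ] ∑[ x < b ] φ (combine i x)
∑-combine zero    b φ = refl
∑-combine (suc a) b φ =
  trans (∑-↑ b φ) (cong (∑[ x < b ] φ (x ↑ˡ (a * b)) +_) (∑-combine a b (φ ∘ (b ↑ʳ_))))

∑-agree-off : ∀ {k} (v : Fin k) {φ ψ : Fin k → ℕ} → (∀ x → x ≢ v → φ x ≡ ψ x) →
              φ v + ∑[ x < k ] ψ x ≡ ψ v + ∑[ x < k ] φ x
∑-agree-off {suc k} v {φ} {ψ} agree = begin
  φ v + sum ψ                  ≡⟨ cong (φ v +_) (sum-remove {i = v} ψ) ⟩
  φ v + (ψ v + rest ψ)         ≡⟨ cong (λ r → φ v + (ψ v + r)) (sym rest-agree) ⟩
  φ v + (ψ v + rest φ)         ≡⟨ x∙yz≈y∙xz (φ v) (ψ v) (rest φ) ⟩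
  ψ v + (φ v + rest φ)         ≡⟨ cong (ψ v +_) (sym (sum-remove {i = v} φ)) ⟩
  ψ v + sum φ                  ∎
  where
  open ≡-Reasoning
  rest : (Fin (suc k) → ℕ) → ℕ
  rest χ = ∑[ j < k ] χ (punchIn v j)
  rest-agree : rest φ ≡ rest ψ
  rest-agree = sum-cong-≗ (λ j → agree (punchIn v j) (punchInᵢ≢i v j))

weight≡∑ : ∀ {k} (f : Fin k → Fin 3) → weight f ≡ ∑[ x < k ] toℕ (f x)
weight≡∑ f = trans (cong listSum (map-tabulate id (toℕ ∘ f))) (listSum-tabulate (toℕ ∘ f))

weight-cong : ∀ {k} {f f′ : Fin k → Fin 3} → (∀ x → f x ≡ f′ x) → weight f ≡ weight f′
weight-cong {f = f} {f′} eq =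
  trans (weight≡∑ f) (trans (sum-cong-≗ (cong toℕ ∘ eq)) (sym (weight≡∑ f′)))

value≤weight : ∀ {k} (f : Fin k → Fin 3) x → toℕ (f x) ≤ weight f
value≤weight {suc k} f x =
  subst (toℕ (f x) ≤_) (sym (trans (weight≡∑ f) (sum-remove {i = x} (toℕ ∘ f)))) (m≤m+n _ _)

weight-updateAt : ∀ {k} (f : Fin k → Fin 3) v c →
                  toℕ (f v) + weight (updateAt f v (const c)) ≡ toℕ c + weight f
weight-updateAt f v c = begin
  toℕ (f v) + weight f′                     ≡⟨ cong (toℕ (f v) +_) (weight≡∑ f′) ⟩
  toℕ (f v) + ∑[ x < _ ] toℕ (f′ x)
    ≡⟨ ∑-agree-off v (λ x x≢v → cong toℕ (sym (updateAt-minimal x v f x≢v))) ⟩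
  toℕ (f′ v) + ∑[ x < _ ] toℕ (f x)
    ≡⟨ cong₂ (λ a b → toℕ a + b) (updateAt-updates v f) (sym (weight≡∑ f)) ⟩
  toℕ c + weight f                          ∎
  where
  open ≡-Reasoning
  f′ = updateAt f v (const c)

weight-blocks : ∀ a b (F : Fin (a * b) → Fin 3) →
                weight F ≡ ∑[ i < a ] weight (λ x → F (combine i x))
weight-blocks a b F =
  trans (weight≡∑ F)
        (trans (∑-combine a b (toℕ ∘ F)) (sym (sum-cong-≗ {a} (λ i → weight≡∑ (λ x → F (combine i x))))))

toℕ-≢ : ∀ {k c} {a b : Fin k} → a ≡ b → toℕ b ≢ c → toℕ a ≢ c
toℕ-≢ a≡b b≢c a≡c = b≢c (trans (cong toℕ (sym a≡b)) a≡c)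

==⇒≡ : ∀ {k} {i j : Fin k} → (i == j) ≡ true → i ≡ j
==⇒≡ {i = i} {j} e = toWitness {a? = i ≟ j} (Equivalence.from T-≡ e)

==-refl : ∀ {k} (i : Fin k) → (i == i) ≡ true
==-refl i = trans (isYes≗does (i ≟ i)) (dec-true (i ≟ i) refl)

∨-true : ∀ a b → a ∨ b ≡ true → a ≡ true ⊎ b ≡ true
∨-true a b e = Sum.map (λ a∨b≡a → trans (sym a∨b≡a) e) (λ a∨b≡b → trans (sym a∨b≡b) e)
                       (∨-sel a b)

module RootedCopy {m} (H : Graph m) (v : Fin m) where

  DominatesOffRoot : (Fin m → Fin 3) → Set
  DominatesOffRoot h = ∀ x → x ≢ v → toℕ (h x) ≡ 0 → ∃ λ y → Adj H x y ≡ true × toℕ (h y) ≡ 2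

  RootGuarded : (Fin m → Fin 3) → Set
  RootGuarded h = ∃ λ y → Adj H v y ≡ true × toℕ (h y) ≡ 2

  rootGuarded? : ∀ h → Dec (RootGuarded h)
  rootGuarded? h = any? (λ y → (Adj H v y ≟ᵇ true) ×-dec (toℕ (h y) ≟ℕ 2))

  completeAtRoot : ∀ h → DominatesOffRoot h → (toℕ (h v) ≡ 0 → RootGuarded h) → IsRDF H h
  completeAtRoot h dom guard x hx≡0 with x ≟ v
  ... | yes refl = guard hx≡0
  ... | no x≢v   = dom x x≢v hx≡0

  rootLabelled-isRDF : ∀ h → DominatesOffRoot h → toℕ (h v) ≢ 0 → IsRDF H h
  rootLabelled-isRDF h dom hv≢0 = completeAtRoot h dom (λ hv≡0 → contradiction hv≡0 hv≢0)

  raiseRoot : (Fin m → Fin 3) → Fin m → Fin 3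
  raiseRoot h = updateAt h v (const 1F)

  raiseRoot-isRDF : ∀ h → DominatesOffRoot h → toℕ (h v) ≡ 0 → IsRDF H (raiseRoot h)
  raiseRoot-isRDF h dom hv≡0 x hx≡0 with x ≟ v
  ... | yes refl = contradiction hx≡0 (toℕ-≢ (updateAt-updates v h) λ ())
  ... | no x≢v with dom x x≢v (trans (cong toℕ (sym (updateAt-minimal x v h x≢v))) hx≡0)
  ...   | y , adj , hy≡2 = y , adj , trans (cong toℕ (updateAt-minimal y v h y≢v)) hy≡2
    where
    y≢v : y ≢ v
    y≢v refl = contradiction (trans (sym hy≡2) hv≡0) λ ()

  rootOne⇒γ-positive : ∀ {γH} → IsγR H γH →
                       (∀ f → IsγRFunction H γH f → toℕ (f v) ≡ 1) → 1 ≤ γH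
  rootOne⇒γ-positive ((f , f-isRDF , f-weight) , _) rootOne =
    subst₂ _≤_ (rootOne f (f-isRDF , f-weight)) f-weight (value≤weight f v)

  module CopyContribution (g : ℕ) (isγH : IsγR H (suc g))
                          (rootOne : ∀ f → IsγRFunction H (suc g) f → toℕ (f v) ≡ 1) where

    rdf-bound : ∀ h → IsRDF H h → suc g ≤ weight h
    rdf-bound = proj₂ isγH

    -- An RDF labelling the root 2 is not a γ_R(H)-function, so it is heavier.
    rootTwo-bound : ∀ h → IsRDF H h → toℕ (h v) ≡ 2 → 2 + g ≤ weight h
    rootTwo-bound h h-isRDF hv≡2 = ≤∧≢⇒< (rdf-bound h h-isRDF) not-γ-function
      where
      not-γ-function : suc g ≢ weight h
      not-γ-function minimal =
        contradiction (trans (sym hv≡2) (rootOne h (h-isRDF , sym minimal))) λ ()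

    -- Raising an unguarded unlabelled root to 1 gives an RDF, so h weighs ≥ g.
    unguarded-bound : ∀ h → DominatesOffRoot h → toℕ (h v) ≡ 0 → g ≤ weight h
    unguarded-bound h dom hv≡0 =
      +-cancelˡ-≤ 1 g (weight h)
        (subst (suc g ≤_) raised-weight (rdf-bound (raiseRoot h) (raiseRoot-isRDF h dom hv≡0)))
      where
      raised-weight : weight (raiseRoot h) ≡ 1 + weight h
      raised-weight = trans (cong (_+ weight (raiseRoot h)) (sym hv≡0)) (weight-updateAt h v 1F)

    record Contribution (h : Fin m → Fin 3) (c : Fin 3) : Set where
      field
        bound          : toℕ c + g ≤ weight h
        zero⇒unguarded : toℕ c ≡ 0 → toℕ (h v) ≡ 0 × ¬ RootGuarded h
        rootTwo⇒two    : toℕ (h v) ≡ 2 → toℕ c ≡ 2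

    contributionOne : ∀ h → IsRDF H h → toℕ (h v) ≢ 2 → Contribution h 1F
    contributionOne h h-isRDF hv≢2 = record
      { bound          = rdf-bound h h-isRDF
      ; zero⇒unguarded = λ ()
      ; rootTwo⇒two    = λ hv≡2 → contradiction hv≡2 hv≢2 }

    contribution : ∀ h → DominatesOffRoot h → Σ (Fin 3) (Contribution h)
    contribution h dom with h v in hv
    ... | 2F = 2F , record
      { bound          = rootTwo-bound h (rootLabelled-isRDF h dom (toℕ-≢ hv λ ())) (cong toℕ hv)
      ; zero⇒unguarded = λ ()
      ; rootTwo⇒two    = λ _ → refl }
    ... | 1F = 1F , contributionOne h (rootLabelled-isRDF h dom (toℕ-≢ hv λ ())) (toℕ-≢ hv λ ())
    ... | 0F with rootGuarded? h
    ...   | yes guarded  = 1F , contributionOne h (completeAtRoot h dom (const guarded)) (toℕ-≢ hv λ ())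
    ...   | no unguarded = 0F , record
      { bound          = unguarded-bound h dom (cong toℕ hv)
      ; zero⇒unguarded = λ _ → cong toℕ hv , unguarded
      ; rootTwo⇒two    = λ hv≡2 → contradiction hv≡2 (toℕ-≢ hv λ ()) }

module RootedProduct {n m} (G : Graph n) (H : Graph m) (v : Fin m) where

  G∘H : Graph (n * m)
  G∘H = rootedProduct G H v

  rpAdj-cases : ∀ i x j y → rpAdj G H v (i , x) (j , y) ≡ true →
                (i ≡ j × Adj H x y ≡ true) ⊎ (x ≡ v × y ≡ v × Adj G i j ≡ true)
  rpAdj-cases i x j y adj with ∨-true ((i == j) ∧ Adj H x y) (((x == v) ∧ (y == v)) ∧ Adj G i j) adj
  ... | inj₁ inCopy =
    inj₁ (==⇒≡ (∧-conicalˡ (i == j) (Adj H x y) inCopy) , ∧-conicalʳ (i == j) (Adj H x y) inCopy)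
  ... | inj₂ betweenRoots =
    inj₂ (==⇒≡ (∧-conicalˡ (x == v) (y == v) roots) , ==⇒≡ (∧-conicalʳ (x == v) (y == v) roots)
         , ∧-conicalʳ ((x == v) ∧ (y == v)) (Adj G i j) betweenRoots)
    where
    roots : (x == v) ∧ (y == v) ≡ true
    roots = ∧-conicalˡ ((x == v) ∧ (y == v)) (Adj G i j) betweenRoots

  rpAdj-copy : ∀ i {x y} → Adj H x y ≡ true → rpAdj G H v (i , x) (i , y) ≡ true
  rpAdj-copy i e rewrite ==-refl i | e = refl

  rpAdj-roots : ∀ {i j} → Adj G i j ≡ true → rpAdj G H v (i , v) (j , v) ≡ true
  rpAdj-roots e rewrite ==-refl v | e = ∨-zeroʳ _

  IsPairRDF : (Fin n × Fin m → Fin 3) → Set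
  IsPairRDF P = ∀ p → toℕ (P p) ≡ 0 → ∃ λ q → rpAdj G H v p q ≡ true × toℕ (P q) ≡ 2

  isRDF⇒isPairRDF : ∀ F → IsRDF G∘H F → IsPairRDF (F ∘ uncurry combine)
  isRDF⇒isPairRDF F F-isRDF (i , x) e with F-isRDF (combine i x) e
  ... | w , adj , Fw≡2 =
    remQuot m w ,
    subst (λ p → rpAdj G H v p (remQuot m w) ≡ true) (remQuot-combine i x) adj ,
    subst (λ z → toℕ (F z) ≡ 2) (sym (combine-remQuot {n} m w)) Fw≡2

  isPairRDF⇒isRDF : ∀ P → IsPairRDF P → IsRDF G∘H (P ∘ remQuot m)
  isPairRDF⇒isRDF P P-isRDF z e with P-isRDF (remQuot m z) e
  ... | (j , y) , adj , Pq≡2 =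
    combine j y ,
    subst (λ q → rpAdj G H v (remQuot m z) q ≡ true) (sym (remQuot-combine j y)) adj ,
    subst (λ q → toℕ (P q) ≡ 2) (sym (remQuot-combine j y)) Pq≡2

  module LowerBound {γG g} (isγG : IsγR G γG) (isγH : IsγR H (suc g))
                    (rootOne : ∀ f → IsγRFunction H (suc g) f → toℕ (f v) ≡ 1)
                    (F : Fin (n * m) → Fin 3) (F-isRDF : IsRDF G∘H F) where
    open RootedCopy H v
    open CopyContribution g isγH rootOne
    open Contribution

    copy : Fin n → Fin m → Fin 3
    copy i x = F (combine i x)

    pairRDF : IsPairRDF (F ∘ uncurry combine)
    pairRDF = isRDF⇒isPairRDF F F-isRDF

    -- Non-root vertices have all their neighbours inside their own copy.
    copy-dominatesOffRoot : ∀ i → DominatesOffRoot (copy i)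
    copy-dominatesOffRoot i x x≢v cx≡0 with pairRDF (i , x) cx≡0
    ... | (j , y) , adj , q≡2 with rpAdj-cases i x j y adj
    ...   | inj₁ (refl , adjH) = y , adjH , q≡2
    ...   | inj₂ (x≡v , _)     = contradiction x≡v x≢v

    contrib : ∀ i → Σ (Fin 3) (Contribution (copy i))
    contrib i = contribution (copy i) (copy-dominatesOffRoot i)

    rootLabel : Fin n → Fin 3
    rootLabel i = proj₁ (contrib i)

    -- A root with contribution 0 is dominated by another root of contribution 2.
    rootLabel-isRDF : IsRDF G rootLabel
    rootLabel-isRDF i ci≡0 with zero⇒unguarded (proj₂ (contrib i)) ci≡0
    ... | hv≡0 , unguarded with pairRDF (i , v) hv≡0
    ...   | (j , y) , adj , q≡2 with rpAdj-cases i v j y adj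
    ...     | inj₁ (refl , adjH)     = contradiction (y , adjH , q≡2) unguarded
    ...     | inj₂ (_ , refl , adjG) = j , adjG , rootTwo⇒two (proj₂ (contrib j)) q≡2

    weight-bound : n * g + γG ≤ weight F
    weight-bound = begin
      n * g + γG                           ≤⟨ +-monoʳ-≤ (n * g) (proj₂ isγG rootLabel rootLabel-isRDF) ⟩
      n * g + weight rootLabel             ≡⟨ cong (n * g +_) (weight≡∑ rootLabel) ⟩
      n * g + ∑[ i < n ] toℕ (rootLabel i) ≡⟨ ∑-+-const (toℕ ∘ rootLabel) g ⟨
      ∑[ i < n ] (toℕ (rootLabel i) + g)   ≤⟨ ∑-mono-≤ (λ i → bound (proj₂ (contrib i))) ⟩
      ∑[ i < n ] weight (copy i)           ≡⟨ weight-blocks n m F ⟨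
      weight F                             ∎
      where open ≤-Reasoning

  module Glued (g0 : Fin n → Fin 3) (f0 : Fin m → Fin 3) (g0-isRDF : IsRDF G g0)
               (f0-isRDF : IsRDF H f0) (f0v≡1 : toℕ (f0 v) ≡ 1) where

    glued : Fin n × Fin m → Fin 3
    glued (i , x) = updateAt f0 v (const (g0 i)) x

    glued-root : ∀ i → glued (i , v) ≡ g0 i
    glued-root i = updateAt-updates v f0

    glued-off : ∀ i {x} → x ≢ v → glued (i , x) ≡ f0 x
    glued-off i x≢v = updateAt-minimal _ v f0 x≢v

    -- Roots are dominated along G; other vertices inside their copy, never by the root.
    glued-isPairRDF : IsPairRDF glued
    glued-isPairRDF (i , x) = dominated (x ≟ v)
      where
      dominated : Dec (x ≡ v) → toℕ (glued (i , x)) ≡ 0 →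
                  ∃ λ q → rpAdj G H v (i , x) q ≡ true × toℕ (glued q) ≡ 2
      dominated (yes refl) e with g0-isRDF i (trans (cong toℕ (sym (glued-root i))) e)
      ... | j , adjG , gj≡2 = (j , v) , rpAdj-roots adjG , trans (cong toℕ (glued-root j)) gj≡2
      dominated (no x≢v) e with f0-isRDF x (trans (cong toℕ (sym (glued-off i x≢v))) e)
      ... | y , adjH , fy≡2 = (i , y) , rpAdj-copy i adjH , trans (cong toℕ (glued-off i y≢v)) fy≡2
        where
        y≢v : y ≢ v
        y≢v refl = contradiction (trans (sym fy≡2) f0v≡1) λ ()

    glued-copy-weight : ∀ {g} → weight f0 ≡ suc g →
                        ∀ i → weight (λ x → glued (i , x)) ≡ toℕ (g0 i) + g
    glued-copy-weight {g} f0-weight i = suc-injective (begin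
      suc (weight (λ x → glued (i , x)))     ≡⟨ cong (_+ weight (λ x → glued (i , x))) (sym f0v≡1) ⟩
      toℕ (f0 v) + weight (λ x → glued (i , x)) ≡⟨ weight-updateAt f0 v (g0 i) ⟩
      toℕ (g0 i) + weight f0                 ≡⟨ cong (toℕ (g0 i) +_) f0-weight ⟩
      toℕ (g0 i) + suc g                     ≡⟨ +-suc (toℕ (g0 i)) g ⟩
      suc (toℕ (g0 i) + g)                   ∎)
      where open ≡-Reasoning

    glued-weight : ∀ {g} → weight f0 ≡ suc g → weight (glued ∘ remQuot m) ≡ n * g + weight g0
    glued-weight {g} f0-weight = begin
      weight (glued ∘ remQuot m)             ≡⟨ weight-blocks n m (glued ∘ remQuot m) ⟩
      ∑[ i < n ] weight (λ x → glued (remQuot m (combine i x)))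
        ≡⟨ sum-cong-≗ {n} (λ i → weight-cong (λ x → cong glued (remQuot-combine i x))) ⟩
      ∑[ i < n ] weight (λ x → glued (i , x)) ≡⟨ sum-cong-≗ {n} (glued-copy-weight f0-weight) ⟩
      ∑[ i < n ] (toℕ (g0 i) + g)            ≡⟨ ∑-+-const (toℕ ∘ g0) g ⟩
      n * g + ∑[ i < n ] toℕ (g0 i)          ≡⟨ cong (n * g +_) (weight≡∑ g0) ⟨
      n * g + weight g0                      ∎
      where open ≡-Reasoning

    glued-isRDF : IsRDF G∘H (glued ∘ remQuot m)
    glued-isRDF = isPairRDF⇒isRDF glued glued-isPairRDF

mainTheorem4 : ∀ {n m : ℕ} → 2 ≤ n → 2 ≤ m →
    (G : Graph n) (H : Graph m) (v : Fin m) →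
    (γG γH γGH : ℕ) → IsγR G γG → IsγR H γH → IsγR (rootedProduct G H v) γGH →
    (∀ f → IsγRFunction H γH f → toℕ (f v) ≡ 1) →
    γGH ≡ n * (γH ∸ 1) + γG
mainTheorem4 _ _ G H v γG zero γGH _ isγH _ rootOne =
  contradiction (RootedCopy.rootOne⇒γ-positive H v isγH rootOne) λ ()
mainTheorem4 {n} _ _ G H v γG (suc g) γGH isγG isγH isγGH rootOne = ≤-antisym upper lower
  where
  open RootedProduct G H v
  upper : γGH ≤ n * g + γG
  upper with (g0 , g0-isRDF , refl) ← proj₁ isγG | (f0 , f0-isRDF , f0-weight) ← proj₁ isγH =
    subst (γGH ≤_) (glued-weight f0-weight) (proj₂ isγGH _ glued-isRDF)
    where open Glued g0 f0 g0-isRDF f0-isRDF (rootOne f0 (f0-isRDF , f0-weight))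
  lower : n * g + γG ≤ γGH
  lower with (F , F-isRDF , refl) ← proj₁ isγGH = LowerBound.weight-bound isγG isγH rootOne F F-isRDF
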